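{- Consider the generalized Sudoku problem with data $n, \pi_1, \pi_2, \pi_3, i_1, \ldots, i_k, g_{i_1}, \ldots, g_{i_k}$ and solution set $S(n,g)$. Let $x \in S(n, g)$ and let $J$ be a $p$-$q$-rectangle for some $2 \le p \le n$ and $1 \le q \le n$ with $J \cap \{i_1, \ldots, i_k\} = \emptyset$. If $x$ is minimal on $J$, then the generalized Sudoku problem has more than one solution.
   Context: For $y \in \mathbb{Z}^s$ write $y <> \mathbf{0}$ if every component of $y$ is nonzero. Let $n \ge 2$ and $s(n) = \sum_{i=1}^{n-1} i$. The $s(n) \times n$ matrix $A(n)$ is defined inductively: $A(1)$ is the empty matrix, and $A(m) = \begin{pmatrix} \mathbf{1}_{m-1} & -U_{m-1} \\ \mathbf{0}_{s(m-1)} & A(m-1) \end{pmatrix}$, where $\mathbf{1}_{m-1}$ is the all-ones column, $U_{m-1}$ the identity matrix and $\mathbf{0}_{s(m-1)}$ the zero column of length $s(m-1)$. Let $A$ be the $(n \cdot s(n)) \times n^2$ block-diagonal matrix whose $n$ diagonal blocks all equal $A(n)$. For a permutation $\pi$ of $\{1,\ldots,n^2\}$, $A_\pi$ is the matrix whose $j$-th column is the $\pi^{ -1}(j)$-th column of $A$, and the constraint sets of $\pi$ are $cs_\pi(j) = \{\pi(i) \mid (j-1)n + 1 \le i \le jn\}$, $j=1,\ldots,n$. Generalized Sudoku problem: given permutations $\pi_1, \pi_2, \pi_3$ of $\{1, \ldots, n^2\}$, an integer $0 \le k \le n^2$, an index set $\{i_1, \ldots, i_k\} \subset \{1, \ldots,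 n^2\}$ and givens $g_{i_l} \in \mathbb{Z}$ with $1 \le g_{i_l} \le n$, its solution set is $S(n,g) = \{x \in \mathbb{Z}^{n^2} \mid 1 \le x_i \le n \ (i = 1,\ldots,n^2),\ A_{\pi_r}x <> \mathbf{0}\ (r = 1,2,3),\ x_{i_l} = g_{i_l}\ (l = 1, \ldots, k)\}$. For $1 \le p, q \le n$, a set $J \subset \{1, \ldots, n^2\}$ with $p \cdot q$ elements is a $p$-$q$-rectangle if for each $r = 1,2,3$ there exist distinct indices $j_{r,1}, \ldots, j_{r,q} \in \{1, \ldots, n\}$ with $\sharp(J \cap cs_{\pi_r}(j_{r,s})) = p$ for $s = 1, \ldots, q$. A point $x \in S(n,g)$ is minimal on a $p$-$q$-rectangle $J$ if $\sharp\{x_i \mid i \in J\} = p$. -}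

module Defs where

open import Data.Nat as ℕ using (ℕ; zero; suc)
open import Data.Integer as ℤ using (ℤ; +_; -_; _≤_)
open import Data.Fin as Fin using (Fin; splitAt; quotRem; combine)
open import Data.Fin.Subset using (Subset; _∈_; _∉_; _∩_; ⋃; ⁅_⁆; ∣_∣)
open import Data.Fin.Permutation using (Permutation′; _⟨$⟩ʳ_; _⟨$⟩ˡ_)
open import Data.List as List using (List)
open import Data.List.Membership.Propositional as LM using ()
open import Data.List.Relation.Unary.Unique.Propositional using (Unique)
open import Data.Product using (Σ; ∃; ∃-syntax; _×_; _,_; proj₁; proj₂)
open import Data.Sum using (inj₁; inj₂)
open import Data.Bool using (if_then_else_)
open import Relation.Nullary using (¬_; does)
open import Relation.Binary.PropositionalEquality using (_≡_; _≢_)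
open import Function.Definitions using (Injective)
open import Function.Bundles using (_⇔_)

Matrix : ℕ → ℕ → Set
Matrix m k = Fin m → Fin k → ℤ

∑ : ∀ {k} → (Fin k → ℤ) → ℤ
∑ {zero}  f = + 0
∑ {suc k} f = f Fin.zero ℤ.+ ∑ (λ i → f (Fin.suc i))

_·_ : ∀ {m k} → Matrix m k → (Fin k → ℤ) → (Fin m → ℤ)
(M · x) i = ∑ (λ j → M i j ℤ.* x j)

_<>0 : ∀ {m} → (Fin m → ℤ) → Set
y <>0 = ∀ i → y i ≢ + 0

-- s(m) = Σ_{i=1}^{m-1} i ; s(suc m) = m + s(m)
s : ℕ → ℕ
s zero    = 0
s (suc m) = m ℕ.+ s m

U : ∀ m → Matrix m m
U m r c = if does (r Fin.≟ c) then + 1 else + 0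

-- A(m), defined inductively:
--   A(m+1) = ( 1_m   -U_m )
--            ( 0     A(m) )
-- (A(0), A(1) have no rows.)
Amat : ∀ m → Matrix (s m) m
Amat zero    ()
Amat (suc m) i j with splitAt m i
Amat (suc m) i Fin.zero    | inj₁ r = + 1
Amat (suc m) i (Fin.suc c) | inj₁ r = - U m r c
Amat (suc m) i Fin.zero    | inj₂ r = + 0
Amat (suc m) i (Fin.suc c) | inj₂ r = Amat m r c

-- block-diagonal matrix with n diagonal blocks equal to A(n).
-- Row index  combine b r  (= b * s(n) + r) and column index  combine b' c  (= b' * n + c).
Ablock : ∀ n → Matrix (n ℕ.* s n) (n ℕ.* n)
Ablock n i j with quotRem {n} (s n) i | quotRem {n} n j
... | (r , b) | (c , b') = if does (b Fin.≟ b') then Amat n r c else + 0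

Aπ : ∀ n → Permutation′ (n ℕ.* n) → Matrix (n ℕ.* s n) (n ℕ.* n)
Aπ n π i j = Ablock n i (π ⟨$⟩ˡ j)

-- constraint sets cs_π(j) = { π(i) | (j-1)n+1 ≤ i ≤ jn }  (0-indexed: i = j*n + c, c < n)
cs : ∀ n → Permutation′ (n ℕ.* n) → Fin n → Subset (n ℕ.* n)
cs n π j = ⋃ (List.map (λ c → ⁅ π ⟨$⟩ʳ combine {n} {n} j c ⁆) (List.allFin n))

record SudokuData (n : ℕ) : Set where
  field
    π₁ π₂ π₃ : Permutation′ (n ℕ.* n)
    k        : ℕ
    idx      : Fin k → Fin (n ℕ.* n)
    idx-inj  : Injective _≡_ _≡_ idx
    g        : Fin k → ℤ
    g-range  : ∀ l → (+ 1 ≤ g l) × (g l ≤ + n)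

open SudokuData public

perm : ∀ {n} → SudokuData n → Fin 3 → Permutation′ (n ℕ.* n)
perm D Fin.zero                     = π₁ D
perm D (Fin.suc Fin.zero)           = π₂ D
perm D (Fin.suc (Fin.suc Fin.zero)) = π₃ D

InS : ∀ {n} → SudokuData n → (Fin (n ℕ.* n) → ℤ) → Set
InS {n} D x =
    (∀ i → (+ 1 ≤ x i) × (x i ≤ + n))
  × (∀ r → (Aπ n (perm D r) · x) <>0)
  × (∀ l → x (idx D l) ≡ g D l)

IsRectangle : ∀ {n} → SudokuData n → ℕ → ℕ → Subset (n ℕ.* n) → Set
IsRectangle {n} D p q J =
    ∣ J ∣ ≡ p ℕ.* q
  × (∀ r → Σ (Fin q → Fin n) λ js →
        Injective _≡_ _≡_ js
      × (∀ t → ∣ J ∩ cs n (perm D r) (js t) ∣ ≡ p))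

HasCard : (ℤ → Set) → ℕ → Set
HasCard V p = Σ (List ℤ) λ vs → Unique vs × List.length vs ≡ p × (∀ v → (v LM.∈ vs) ⇔ V v)

MinimalOn : ∀ {n} → (Fin (n ℕ.* n) → ℤ) → Subset (n ℕ.* n) → ℕ → Set
MinimalOn x J p = HasCard (λ v → ∃[ i ] (i ∈ J × x i ≡ v)) p

MoreThanOneSolution : ∀ {n} → SudokuData n → Set
MoreThanOneSolution D = ∃[ y ] ∃[ z ] (InS D y × InS D z × ∃[ i ] (y i ≢ z i))

-- A solution x of the generalized Sudoku problem takes pairwise
-- distinct values on every constraint set.  If x is minimal on a
-- p-q-rectangle J, its values on J form a p-element set V.  Every
-- constraint set that meets J is one of the q chosen ones, so it meets J
-- in exactly p cells carrying p distinct values of V, i.e. all of V; hence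
-- its cells outside J carry no value of V.  Exchanging two values a ≠ b
-- of V inside J and keeping x outside J therefore gives a second
-- solution y ≠ x (J contains no given cell).
module Submission where

open import Defs
open import Data.Nat using (ℕ; _≤_)
open import Data.Integer using (ℤ)
open import Data.Fin using (Fin)
open import Data.Fin.Subset using (Subset; _∉_)
import Data.Nat

open import Data.Nat as ℕ using (zero; suc; s≤s)
import Data.Nat.Properties as ℕP
open import Data.Integer as ℤ using (+_; -_)
import Data.Integer.Properties as ℤP
open import Data.Fin as Fin using (splitAt; quotRem; remQuot; combine; _↑ˡ_; _↑ʳ_; punchOut)
import Data.Fin.Properties as FinP
open import Data.Fin.Subset using (_∈_; _∩_; ⋃; ⁅_⁆; ∣_∣)
import Data.Fin.Subset.Properties as SP
open import Data.Fin.Permutation using (Permutation′; _⟨$⟩ʳ_; _⟨$⟩ˡ_; inverseˡ)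
open import Data.List as List using (List; []; _∷_)
import Data.List.Membership.Propositional as LM
import Data.List.Membership.Propositional.Properties as LMP
open import Data.List.Relation.Unary.Any using (here; there; index)
open import Data.List.Relation.Unary.Any.Properties using (lookup-index)
import Data.List.Relation.Unary.All as All
import Data.List.Relation.Unary.AllPairs as AllPairs
open import Data.List.Relation.Unary.Unique.Propositional using (Unique)
open import Data.Vec using (_∷_)
open import Data.Vec.Base using (here; there)
open import Data.Product using (∃; ∃-syntax; _×_; _,_; proj₁; proj₂; swap; uncurry)
open import Data.Sum using (inj₁; inj₂)
open import Data.Bool using (true; false; if_then_else_)
open import Data.Empty using (⊥-elim)
open import Relation.Nullary using (¬_; does; yes; no)
open import Relation.Nullary.Decidable using (dec-true; dec-false)
open import Relation.Binary.PropositionalEquality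
open import Function.Definitions using (Injective)
open import Function.Bundles using (Equivalence; _⇔_)
open import Function using (_∘′_)
import Algebra.Properties.CommutativeMonoid.Sum ℤP.+-0-commutativeMonoid as ℤSum

∑≡sum : ∀ {k} (f : Fin k → ℤ) → ∑ f ≡ ℤSum.sum f
∑≡sum {zero}  f = refl
∑≡sum {suc k} f = cong (λ z → f Fin.zero ℤ.+ z) (∑≡sum (λ i → f (Fin.suc i)))

∑-cong : ∀ {k} {f g : Fin k → ℤ} → (∀ i → f i ≡ g i) → ∑ f ≡ ∑ g
∑-cong {f = f} {g} f≗g = trans (∑≡sum f) (trans (ℤSum.sum-cong-≗ f≗g) (sym (∑≡sum g)))

∑-zero : ∀ {k} (f : Fin k → ℤ) → (∀ i → f i ≡ + 0) → ∑ f ≡ + 0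
∑-zero {zero}  f f≡0 = refl
∑-zero {suc k} f f≡0 = cong₂ ℤ._+_ (f≡0 Fin.zero) (∑-zero _ (λ i → f≡0 (Fin.suc i)))

∑-single : ∀ {k} (f : Fin k → ℤ) (b : Fin k) → (∀ i → i ≢ b → f i ≡ + 0) → ∑ f ≡ f b
∑-single {suc k} f Fin.zero off
  rewrite ∑-zero (λ i → f (Fin.suc i)) (λ i → off (Fin.suc i) (λ ())) = ℤP.+-identityʳ (f Fin.zero)
∑-single {suc k} f (Fin.suc b) off
  rewrite off Fin.zero (λ ())
        | ∑-single (λ i → f (Fin.suc i)) b (λ i i≢b → off (Fin.suc i) (i≢b ∘′ FinP.suc-injective))
  = ℤP.+-identityˡ _

∑-++ : ∀ k m (f : Fin (k ℕ.+ m) → ℤ) → ∑ f ≡ ∑ (λ i → f (i ↑ˡ m)) ℤ.+ ∑ (λ j → f (k ↑ʳ j))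
∑-++ zero    m f = sym (ℤP.+-identityˡ _)
∑-++ (suc k) m f rewrite ∑-++ k m (λ i → f (Fin.suc i)) = sym (ℤP.+-assoc (f Fin.zero) _ _)

∑-combine : ∀ m k (f : Fin (m ℕ.* k) → ℤ) → ∑ f ≡ ∑ {m} (λ i → ∑ {k} (λ j → f (combine i j)))
∑-combine zero    k f = refl
∑-combine (suc m) k f rewrite ∑-++ k (m ℕ.* k) f =
  cong (λ z → ∑ (λ j → f (j ↑ˡ (m ℕ.* k))) ℤ.+ z) (∑-combine m k (λ i → f (k ↑ʳ i)))

·-permute-columns : ∀ {m k} (M : Matrix m k) (π : Permutation′ k) (x : Fin k → ℤ) i →
  ((λ r j → M r (π ⟨$⟩ˡ j)) · x) i ≡ (M · (λ c → x (π ⟨$⟩ʳ c))) i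
·-permute-columns {k = k} M π x i = begin
  ∑ (λ j → M i (π ⟨$⟩ˡ j) ℤ.* x j)                          ≡⟨ ∑≡sum {k} _ ⟩
  ℤSum.sum (λ j → M i (π ⟨$⟩ˡ j) ℤ.* x j)                   ≡⟨ ℤSum.∑-permute _ π ⟩
  ℤSum.sum (λ c → M i (π ⟨$⟩ˡ (π ⟨$⟩ʳ c)) ℤ.* x (π ⟨$⟩ʳ c)) ≡⟨ sym (∑≡sum {k} _) ⟩
  ∑ (λ c → M i (π ⟨$⟩ˡ (π ⟨$⟩ʳ c)) ℤ.* x (π ⟨$⟩ʳ c))
    ≡⟨ ∑-cong (λ c → cong (λ d → M i d ℤ.* x (π ⟨$⟩ʳ c)) (inverseˡ π)) ⟩
  ∑ (λ c → M i c ℤ.* x (π ⟨$⟩ʳ c))                          ∎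
  where open ≡-Reasoning

negU-row : ∀ m (r : Fin m) (y : Fin m → ℤ) → ∑ (λ j → (- U m r j) ℤ.* y j) ≡ - y r
negU-row m r y = trans (∑-single _ r off-diagonal) on-diagonal
  where
  off-diagonal : ∀ j → j ≢ r → (- U m r j) ℤ.* y j ≡ + 0
  off-diagonal j j≢r =
    cong (λ t → (- (if t then + 1 else + 0)) ℤ.* y j) (dec-false (r Fin.≟ j) (j≢r ∘′ sym))
  on-diagonal : (- U m r r) ℤ.* y r ≡ - y r
  on-diagonal = trans (cong (λ t → (- (if t then + 1 else + 0)) ℤ.* y r) (dec-true (r Fin.≟ r) refl))
                      (ℤP.-1*i≡-i (y r))

Amat-top-row : ∀ m (r : Fin m) (i : Fin (s (suc m))) → splitAt m i ≡ inj₁ r → ∀ x →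
  (Amat (suc m) · x) i ≡ x Fin.zero ℤ.- x (Fin.suc r)
Amat-top-row m r i split≡ x with splitAt m i | split≡
... | .(inj₁ r) | refl = cong₂ ℤ._+_ (ℤP.*-identityˡ (x Fin.zero)) (negU-row m r (λ j → x (Fin.suc j)))

Amat-lower-row : ∀ m (r : Fin (s m)) (i : Fin (s (suc m))) → splitAt m i ≡ inj₂ r → ∀ x →
  (Amat (suc m) · x) i ≡ (Amat m · (λ j → x (Fin.suc j))) r
Amat-lower-row m r i split≡ x with splitAt m i | split≡
... | .(inj₂ r) | refl = ℤP.+-identityˡ _

Amat-row-difference : ∀ m (r : Fin (s m)) →
  ∃[ c₁ ] ∃[ c₂ ] (c₁ ≢ c₂ × ∀ x → (Amat m · x) r ≡ x c₁ ℤ.- x c₂)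
Amat-row-difference (suc m) i = by-split (splitAt m i) refl
  where
  by-split : ∀ v → splitAt m i ≡ v →
    ∃[ c₁ ] ∃[ c₂ ] (c₁ ≢ c₂ × ∀ x → (Amat (suc m) · x) i ≡ x c₁ ℤ.- x c₂)
  by-split (inj₁ r) split≡ = Fin.zero , Fin.suc r , (λ ()) , Amat-top-row m r i split≡
  by-split (inj₂ r) split≡ with c₁ , c₂ , c₁≢c₂ , difference ← Amat-row-difference m r =
    Fin.suc c₁ , Fin.suc c₂ , c₁≢c₂ ∘′ FinP.suc-injective ,
    λ x → trans (Amat-lower-row m r i split≡ x) (difference (λ j → x (Fin.suc j)))

Amat-difference-row : ∀ m (c₁ c₂ : Fin m) → c₁ ≢ c₂ →
  ∃[ r ] ∀ x → x c₁ ≡ x c₂ → (Amat m · x) r ≡ + 0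
Amat-difference-row (suc m) Fin.zero Fin.zero c₁≢c₂ = ⊥-elim (c₁≢c₂ refl)
Amat-difference-row (suc m) Fin.zero (Fin.suc d) _ = d ↑ˡ s m , λ x x≡ →
  trans (Amat-top-row m d _ (FinP.splitAt-↑ˡ m d (s m)) x)
        (trans (cong (ℤ._- x (Fin.suc d)) x≡) (ℤP.+-inverseʳ (x (Fin.suc d))))
Amat-difference-row (suc m) (Fin.suc d) Fin.zero _ = d ↑ˡ s m , λ x x≡ →
  trans (Amat-top-row m d _ (FinP.splitAt-↑ˡ m d (s m)) x)
        (trans (cong (λ z → x Fin.zero ℤ.- z) x≡) (ℤP.+-inverseʳ (x Fin.zero)))
Amat-difference-row (suc m) (Fin.suc d₁) (Fin.suc d₂) d₁≢d₂
  with r , vanishes ← Amat-difference-row m d₁ d₂ (d₁≢d₂ ∘′ cong Fin.suc) =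
  m ↑ʳ r , λ x x≡ → trans (Amat-lower-row m r _ (FinP.splitAt-↑ʳ m (s m) r) x) (vanishes (λ j → x (Fin.suc j)) x≡)

Amat-nonzero⇒injective : ∀ m (x : Fin m → ℤ) → (Amat m · x) <>0 → Injective _≡_ _≡_ x
Amat-nonzero⇒injective m x nonzero {c₁} {c₂} x≡ with c₁ Fin.≟ c₂
... | yes c₁≡c₂ = c₁≡c₂
... | no c₁≢c₂ with r , vanishes ← Amat-difference-row m c₁ c₂ c₁≢c₂ = ⊥-elim (nonzero r (vanishes x x≡))

injective⇒Amat-nonzero : ∀ m (x : Fin m → ℤ) → Injective _≡_ _≡_ x → (Amat m · x) <>0
injective⇒Amat-nonzero m x injective r row≡0 with c₁ , c₂ , c₁≢c₂ , difference ← Amat-row-difference m r =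
  c₁≢c₂ (injective (ℤP.i-j≡0⇒i≡j _ _ (trans (sym (difference x)) row≡0)))

quotRem-combine : ∀ {m} k (b : Fin m) (c : Fin k) → quotRem {m} k (combine b c) ≡ (c , b)
quotRem-combine k b c = cong swap (FinP.remQuot-combine b c)

Ablock-row : ∀ n (i : Fin (n ℕ.* s n)) (x : Fin (n ℕ.* n) → ℤ) →
  (Ablock n · x) i ≡ (Amat n · (λ c → x (combine (proj₂ (quotRem {n} (s n) i)) c))) (proj₁ (quotRem {n} (s n) i))
Ablock-row n i x = begin
  ∑ (λ j → Ablock n i j ℤ.* x j)
    ≡⟨ ∑-combine n n _ ⟩
  ∑ {n} (λ b′ → ∑ {n} (λ c → Ablock n i (combine b′ c) ℤ.* x (combine b′ c)))
    ≡⟨ ∑-cong (λ b′ → ∑-cong (λ c → cong (λ q → entry b′ (proj₂ q) (proj₁ q) c) (quotRem-combine n b′ c))) ⟩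
  ∑ {n} (λ b′ → ∑ {n} (λ c → entry b′ b′ c c))
    ≡⟨ ∑-single _ b other-block ⟩
  ∑ {n} (λ c → entry b b c c)
    ≡⟨ ∑-cong (λ c → cong (λ t → (if t then Amat n r c else + 0) ℤ.* x (combine b c)) (dec-true (b Fin.≟ b) refl)) ⟩
  (Amat n · (λ c → x (combine b c))) r ∎
  where
  open ≡-Reasoning
  r : Fin (s n)
  r = proj₁ (quotRem {n} (s n) i)
  b : Fin n
  b = proj₂ (quotRem {n} (s n) i)
  -- the term of column combine b′ c, given the block b″ and position c′ that quotRem assigns to it
  entry : Fin n → Fin n → Fin n → Fin n → ℤ
  entry b′ b″ c′ c = (if does (b Fin.≟ b″) then Amat n r c′ else + 0) ℤ.* x (combine b′ c)
  other-block : ∀ b′ → b′ ≢ b → ∑ {n} (λ c → entry b′ b′ c c) ≡ + 0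
  other-block b′ b′≢b = ∑-zero _ (λ c →
    cong (λ t → (if t then Amat n r c else + 0) ℤ.* x (combine b′ c)) (dec-false (b Fin.≟ b′) (b′≢b ∘′ sym)))

Aπ-row : ∀ n (π : Permutation′ (n ℕ.* n)) (i : Fin (n ℕ.* s n)) (x : Fin (n ℕ.* n) → ℤ) →
  (Aπ n π · x) i ≡ (Amat n · (λ c → x (π ⟨$⟩ʳ combine (proj₂ (quotRem {n} (s n) i)) c))) (proj₁ (quotRem {n} (s n) i))
Aπ-row n π i x = trans (·-permute-columns (Ablock n) π x i) (Ablock-row n i (λ c → x (π ⟨$⟩ʳ c)))

∈-⋃-singletons⁻ : ∀ {m K} (f : Fin m → Fin K) (cs : List (Fin m)) {u} →
  u ∈ ⋃ (List.map (λ c → ⁅ f c ⁆) cs) → ∃ λ c → u ≡ f c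
∈-⋃-singletons⁻ f []       u∈ = ⊥-elim (SP.∉⊥ u∈)
∈-⋃-singletons⁻ f (c ∷ cs) u∈ with SP.x∈p∪q⁻ ⁅ f c ⁆ _ u∈
... | inj₁ u∈fc = c , SP.x∈⁅y⁆⇒x≡y (f c) u∈fc
... | inj₂ u∈⋃  = ∈-⋃-singletons⁻ f cs u∈⋃

∈-⋃-singletons⁺ : ∀ {m K} (f : Fin m → Fin K) (cs : List (Fin m)) {c} →
  c LM.∈ cs → f c ∈ ⋃ (List.map (λ c → ⁅ f c ⁆) cs)
∈-⋃-singletons⁺ f (c ∷ cs) (here refl) = SP.p⊆p∪q _ (SP.x∈⁅x⁆ (f c))
∈-⋃-singletons⁺ f (c ∷ cs) (there c∈) = SP.q⊆p∪q ⁅ f c ⁆ _ (∈-⋃-singletons⁺ f cs c∈)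

module ConstraintSets (n : ℕ) (π : Permutation′ (n ℕ.* n)) where

  cs⁻ : ∀ b {u} → u ∈ cs n π b → ∃ λ c → u ≡ π ⟨$⟩ʳ combine b c
  cs⁻ b = ∈-⋃-singletons⁻ (λ c → π ⟨$⟩ʳ combine b c) (List.allFin n)

  cs⁺ : ∀ b c → π ⟨$⟩ʳ combine b c ∈ cs n π b
  cs⁺ b c = ∈-⋃-singletons⁺ (λ c → π ⟨$⟩ʳ combine b c) (List.allFin n) (LMP.∈-allFin c)

  π-injective : Injective _≡_ _≡_ (π ⟨$⟩ʳ_)
  π-injective π≡ = trans (sym (inverseˡ π)) (trans (cong (π ⟨$⟩ˡ_) π≡) (inverseˡ π))

  cs-disjoint : ∀ b b′ {u} → u ∈ cs n π b → u ∈ cs n π b′ → b ≡ b′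
  cs-disjoint b b′ u∈ u∈′ with c , u≡ ← cs⁻ b u∈ | c′ , u≡′ ← cs⁻ b′ u∈′ =
    FinP.combine-injectiveˡ b c b′ c′ (π-injective (trans (sym u≡) u≡′))

InjectiveOn : ∀ {K} → (Fin K → ℤ) → Subset K → Set
InjectiveOn x S = ∀ {u v} → u ∈ S → v ∈ S → x u ≡ x v → u ≡ v

module SudokuCondition (n : ℕ) (π : Permutation′ (n ℕ.* n)) (x : Fin (n ℕ.* n) → ℤ) where
  open ConstraintSets n π

  nonzero⇒injectiveOn-cs : (Aπ n π · x) <>0 → ∀ b → InjectiveOn x (cs n π b)
  nonzero⇒injectiveOn-cs nonzero b u∈ v∈ x≡ with c₁ , refl ← cs⁻ b u∈ | c₂ , refl ← cs⁻ b v∈ =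
    cong (λ c → π ⟨$⟩ʳ combine b c) (Amat-nonzero⇒injective n _ block-nonzero x≡)
    where
    block-nonzero : (Amat n · (λ c → x (π ⟨$⟩ʳ combine b c))) <>0
    block-nonzero r row≡0 = nonzero (combine b r) (trans (Aπ-row n π (combine b r) x)
      (subst (λ q → (Amat n · (λ c → x (π ⟨$⟩ʳ combine (proj₂ q) c))) (proj₁ q) ≡ + 0)
             (sym (quotRem-combine (s n) b r)) row≡0))

  injectiveOn-cs⇒nonzero : (∀ b → InjectiveOn x (cs n π b)) → (Aπ n π · x) <>0
  injectiveOn-cs⇒nonzero injective i row≡0 =
    injective⇒Amat-nonzero n _ block-injective (proj₁ (quotRem {n} (s n) i)) (trans (sym (Aπ-row n π i x)) row≡0)
    where
    b : Fin n
    b = proj₂ (quotRem {n} (s n) i)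
    block-injective : Injective _≡_ _≡_ (λ c → x (π ⟨$⟩ʳ combine b c))
    block-injective {c₁} {c₂} x≡ =
      FinP.combine-injectiveʳ b c₁ b c₂ (π-injective (injective b (cs⁺ b c₁) (cs⁺ b c₂) x≡))

record Enumeration {K} (S : Subset K) (m : ℕ) : Set where
  field
    elem      : Fin m → Fin K
    injective : Injective _≡_ _≡_ elem
    elem∈     : ∀ i → elem i ∈ S
    onto      : ∀ {u} → u ∈ S → ∃ λ i → elem i ≡ u

enumerate : ∀ {K} (S : Subset K) → Enumeration S ∣ S ∣
enumerate {zero} Data.Vec.[] = record { elem = λ () ; injective = λ {} ; elem∈ = λ () ; onto = λ () }
enumerate {suc K} (true ∷ S) = record { elem = elem′ ; injective = injective′ ; elem∈ = elem∈′ ; onto = onto′ }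
  where
  open Enumeration (enumerate S)
  elem′ : Fin (suc ∣ S ∣) → Fin (suc K)
  elem′ Fin.zero    = Fin.zero
  elem′ (Fin.suc i) = Fin.suc (elem i)
  injective′ : Injective _≡_ _≡_ elem′
  injective′ {Fin.zero}  {Fin.zero}  _ = refl
  injective′ {Fin.suc i} {Fin.suc j} e = cong Fin.suc (injective (FinP.suc-injective e))
  elem∈′ : ∀ i → elem′ i ∈ (true ∷ S)
  elem∈′ Fin.zero    = here
  elem∈′ (Fin.suc i) = there (elem∈ i)
  onto′ : ∀ {u} → u ∈ (true ∷ S) → ∃ λ i → elem′ i ≡ u
  onto′ here      = Fin.zero , refl
  onto′ (there u∈) with i , refl ← onto u∈ = Fin.suc i , refl
enumerate {suc K} (false ∷ S) = record
  { elem      = λ i → Fin.suc (elem i)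
  ; injective = λ e → injective (FinP.suc-injective e)
  ; elem∈     = λ i → there (elem∈ i)
  ; onto      = onto′
  }
  where
  open Enumeration (enumerate S)
  onto′ : ∀ {u} → u ∈ (false ∷ S) → ∃ λ i → Fin.suc (elem i) ≡ u
  onto′ (there u∈) with i , refl ← onto u∈ = i , refl

enumerate-size : ∀ {K m} (S : Subset K) → ∣ S ∣ ≡ m → Enumeration S m
enumerate-size S refl = enumerate S

injection-bound : ∀ {K m} (S : Subset K) (f : Fin m → Fin K) → Injective _≡_ _≡_ f → (∀ i → f i ∈ S) → m ≤ ∣ S ∣
injection-bound {m = m} S f f-injective f∈ = FinP.injective⇒≤ {f = position} position-injective
  where
  open Enumeration (enumerate S)
  position : Fin m → Fin ∣ S ∣
  position i = proj₁ (onto (f∈ i))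
  position-injective : Injective _≡_ _≡_ position
  position-injective {i} {j} e =
    f-injective (trans (sym (proj₂ (onto (f∈ i)))) (trans (cong elem e) (proj₂ (onto (f∈ j)))))

injection-covers : ∀ (vs : List ℤ) {m} (g : Fin m → ℤ) → Injective _≡_ _≡_ g → (∀ i → g i LM.∈ vs) →
  List.length vs ≤ m → ∀ {w} → w LM.∈ vs → ∃ λ i → g i ≡ w
injection-covers (v ∷ vs) {m} g g-injective g∈ length≤ {w} w∈ with FinP.any? (λ i → g i ℤ.≟ w)
... | yes hit = hit
... | no miss = ⊥-elim (ℕP.1+n≰n (ℕP.≤-trans length≤ (FinP.injective⇒≤ {f = position} position-injective)))
  where
  avoids : ∀ i → index w∈ ≢ index (g∈ i)
  avoids i e = miss (i , sym (trans (lookup-index w∈) (trans (cong (List.lookup (v ∷ vs)) e) (sym (lookup-index (g∈ i))))))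
  position : Fin m → Fin (List.length vs)
  position i = punchOut (avoids i)
  position-injective : Injective _≡_ _≡_ position
  position-injective {i} {j} e = g-injective (trans (lookup-index (g∈ i))
    (trans (cong (List.lookup (v ∷ vs)) (FinP.punchOut-injective (avoids i) (avoids j) e)) (sym (lookup-index (g∈ j)))))

remQuot-injective : ∀ {m} k → Injective _≡_ _≡_ (remQuot {m} k)
remQuot-injective {m} k {i} {j} e =
  trans (sym (FinP.combine-remQuot {m} k i)) (trans (cong (uncurry combine) e) (FinP.combine-remQuot {m} k j))

module Rectangle (n : ℕ) (π : Permutation′ (n ℕ.* n)) (J : Subset (n ℕ.* n)) (p q : ℕ)
  (∣J∣≡pq : ∣ J ∣ ≡ p ℕ.* q) (js : Fin q → Fin n) (js-injective : Injective _≡_ _≡_ js)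
  (js-meet : ∀ t → ∣ J ∩ cs n π (js t) ∣ ≡ p) where

  open ConstraintSets n π

  private
    module Cells (t : Fin q) = Enumeration (enumerate-size (J ∩ cs n π (js t)) (js-meet t))

  cell : Fin q → Fin p → Fin (n ℕ.* n)
  cell t = Cells.elem t

  cell∈J : ∀ t i → cell t i ∈ J
  cell∈J t i = proj₁ (SP.x∈p∩q⁻ J _ (Cells.elem∈ t i))

  cell∈cs : ∀ t i → cell t i ∈ cs n π (js t)
  cell∈cs t i = proj₂ (SP.x∈p∩q⁻ J _ (Cells.elem∈ t i))

  -- distinct labels (t, i) give distinct cells, as the chosen constraint sets are disjoint
  cell-injective : ∀ {t i t′ i′} → cell t i ≡ cell t′ i′ → t ≡ t′ × i ≡ i′
  cell-injective {t} {i} {t′} {i′} cell≡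
    with refl ← js-injective (cs-disjoint (js t) (js t′) (cell∈cs t i) (subst (_∈ cs n π (js t′)) (sym cell≡) (cell∈cs t′ i′)))
    = refl , Cells.injective t cell≡

  -- Counting: J is exhausted by the p·q cells, so every constraint set meeting J is a chosen one.
  meets⇒chosen : ∀ b {u} → u ∈ J → u ∈ cs n π b → ∃ λ t → js t ≡ b
  meets⇒chosen b {u} u∈J u∈cs with FinP.any? (λ t → js t Fin.≟ b)
  ... | yes chosen  = chosen
  ... | no unchosen = ⊥-elim (ℕP.1+n≰n (ℕP.≤-trans (injection-bound J cells+u cells+u-injective cells+u∈J)
                                                     (ℕP.≤-reflexive (trans ∣J∣≡pq (ℕP.*-comm p q)))))
    where
    -- u together with the p·q cells: 1 + q·p distinct cells of J
    cells+u : Fin (suc (q ℕ.* p)) → Fin (n ℕ.* n)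
    cells+u Fin.zero    = u
    cells+u (Fin.suc k) = uncurry cell (remQuot {q} p k)
    cells+u∈J : ∀ k → cells+u k ∈ J
    cells+u∈J Fin.zero    = u∈J
    cells+u∈J (Fin.suc k) = cell∈J _ _
    cell≢u : ∀ t i → cell t i ≢ u
    cell≢u t i cell≡u = unchosen (t , cs-disjoint (js t) b (subst (_∈ cs n π (js t)) cell≡u (cell∈cs t i)) u∈cs)
    cells+u-injective : Injective _≡_ _≡_ cells+u
    cells+u-injective {Fin.zero}  {Fin.zero}  _ = refl
    cells+u-injective {Fin.zero}  {Fin.suc k} e = ⊥-elim (cell≢u _ _ (sym e))
    cells+u-injective {Fin.suc k} {Fin.zero}  e = ⊥-elim (cell≢u _ _ e)
    cells+u-injective {Fin.suc k} {Fin.suc k′} e with t≡ , i≡ ← cell-injective e =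
      cong Fin.suc (remQuot-injective p (cong₂ _,_ t≡ i≡))

  cell-values-injective : ∀ (x : Fin (n ℕ.* n) → ℤ) → (∀ b → InjectiveOn x (cs n π b)) →
    ∀ t → Injective _≡_ _≡_ (λ i → x (cell t i))
  cell-values-injective x injective t x≡ = Cells.injective t (injective (js t) (cell∈cs t _) (cell∈cs t _) x≡)

  -- Exclusion: if x is injective on the constraint sets and its values on J lie
  -- in a list of at most p values, then a constraint set meeting J carries none
  -- of these values outside J (the p cells inside already use all of them).
  values-outside : ∀ (x : Fin (n ℕ.* n) → ℤ) → (∀ b → InjectiveOn x (cs n π b)) →
    (vs : List ℤ) → List.length vs ≤ p → (∀ {i} → i ∈ J → x i LM.∈ vs) →
    ∀ {b u v} → u ∈ cs n π b → v ∈ cs n π b → u ∈ J → v ∉ J → ¬ (x v LM.∈ vs)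
  values-outside x injective vs length≤p x∈vs {b} u∈cs v∈cs u∈J v∉J xv∈vs
    with t , refl ← meets⇒chosen b u∈J u∈cs
    with i , xcell≡xv ← injection-covers vs (λ i → x (cell t i)) (cell-values-injective x injective t) (λ i → x∈vs (cell∈J t i)) length≤p xv∈vs
    = v∉J (subst (_∈ J) (injective b (cell∈cs t i) v∈cs xcell≡xv) (cell∈J t i))

recolour : ∀ {K} → (ℤ → ℤ) → Subset K → (Fin K → ℤ) → Fin K → ℤ
recolour σ J x i with i SP.∈? J
... | yes _ = σ (x i)
... | no _  = x i

module _ {K} {σ : ℤ → ℤ} {J : Subset K} {x : Fin K → ℤ} where

  recolour-inside : ∀ {i} → i ∈ J → recolour σ J x i ≡ σ (x i)
  recolour-inside {i} i∈J with i SP.∈? J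
  ... | yes _   = refl
  ... | no i∉J = ⊥-elim (i∉J i∈J)

  recolour-outside : ∀ {i} → i ∉ J → recolour σ J x i ≡ x i
  recolour-outside {i} i∉J with i SP.∈? J
  ... | yes i∈J = ⊥-elim (i∉J i∈J)
  ... | no _    = refl

  recolour-injectiveOn : ∀ {S} (vs : List ℤ) → Injective _≡_ _≡_ σ → (∀ {z} → z LM.∈ vs → σ z LM.∈ vs) →
    (∀ {i} → i ∈ J → x i LM.∈ vs) → InjectiveOn x S →
    (∀ {u v} → u ∈ S → v ∈ S → u ∈ J → v ∉ J → ¬ (x v LM.∈ vs)) →
    InjectiveOn (recolour σ J x) S
  recolour-injectiveOn {S} vs σ-injective σ-preserves x∈vs injective avoid {u} {v} u∈S v∈S y≡
    with u SP.∈? J | v SP.∈? J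
  ... | yes u∈J | yes v∈J = injective u∈S v∈S (σ-injective y≡)
  ... | no _    | no _    = injective u∈S v∈S y≡
  ... | yes u∈J | no v∉J  = ⊥-elim (avoid u∈S v∈S u∈J v∉J (subst (LM._∈ vs) y≡ (σ-preserves (x∈vs u∈J))))
  ... | no u∉J  | yes v∈J = ⊥-elim (avoid v∈S u∈S v∈J u∉J (subst (LM._∈ vs) (sym y≡) (σ-preserves (x∈vs v∈J))))

module Transposition (a b : ℤ) where

  τ : ℤ → ℤ
  τ z with z ℤ.≟ a | z ℤ.≟ b
  ... | yes _ | _     = b
  ... | no _  | yes _ = a
  ... | no _  | no _  = z

  τ-a : τ a ≡ b
  τ-a with a ℤ.≟ a | a ℤ.≟ b
  ... | yes _   | _ = refl
  ... | no a≢a | _ = ⊥-elim (a≢a refl)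

  τ-b : τ b ≡ a
  τ-b with b ℤ.≟ a | b ℤ.≟ b
  ... | yes b≡a | _       = b≡a
  ... | no _    | yes _   = refl
  ... | no _    | no b≢b = ⊥-elim (b≢b refl)

  τ-other : ∀ {z} → z ≢ a → z ≢ b → τ z ≡ z
  τ-other {z} z≢a z≢b with z ℤ.≟ a | z ℤ.≟ b
  ... | yes z≡a | _       = ⊥-elim (z≢a z≡a)
  ... | no _    | yes z≡b = ⊥-elim (z≢b z≡b)
  ... | no _    | no _    = refl

  data Position (z : ℤ) : Set where
    is-a  : z ≡ a → Position z
    is-b  : z ≡ b → Position z
    other : z ≢ a → z ≢ b → Position z

  position : ∀ z → Position z
  position z with z ℤ.≟ a | z ℤ.≟ b
  ... | yes z≡a | _       = is-a z≡a
  ... | no _    | yes z≡b = is-b z≡b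
  ... | no z≢a  | no z≢b  = other z≢a z≢b

  τ-involutive : ∀ z → τ (τ z) ≡ z
  τ-involutive z with position z
  ... | is-a refl       = trans (cong τ τ-a) τ-b
  ... | is-b refl       = trans (cong τ τ-b) τ-a
  ... | other z≢a z≢b = trans (cong τ (τ-other z≢a z≢b)) (τ-other z≢a z≢b)

  τ-injective : Injective _≡_ _≡_ τ
  τ-injective {z} {w} τ≡ = trans (sym (τ-involutive z)) (trans (cong τ τ≡) (τ-involutive w))

  τ-preserves : ∀ {vs : List ℤ} → a LM.∈ vs → b LM.∈ vs → ∀ {z} → z LM.∈ vs → τ z LM.∈ vs
  τ-preserves {vs} a∈ b∈ {z} z∈ with position z
  ... | is-a refl       = subst (LM._∈ vs) (sym τ-a) b∈
  ... | is-b refl       = subst (LM._∈ vs) (sym τ-b) a∈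
  ... | other z≢a z≢b = subst (LM._∈ vs) (sym (τ-other z≢a z≢b)) z∈

two-distinct-members : ∀ (vs : List ℤ) → Unique vs → 2 ≤ List.length vs →
  ∃[ a ] ∃[ b ] (a ≢ b × a LM.∈ vs × b LM.∈ vs)
two-distinct-members (a ∷ b ∷ _) ((a≢b All.∷ _) AllPairs.∷ _) _ = a , b , a≢b , here refl , there (here refl)
two-distinct-members (_ ∷ []) _ (s≤s ())

module ExchangedSolution {n} (D : SudokuData n) (x : Fin (n ℕ.* n) → ℤ) (x∈S : InS D x)
  (p q : ℕ) (J : Subset (n ℕ.* n)) (rectangle : IsRectangle D p q J) (givens∉J : ∀ l → idx D l ∉ J)
  (vs : List ℤ) (length≤p : List.length vs ≤ p) (vs-values : ∀ v → (v LM.∈ vs) ⇔ (∃[ i ] (i ∈ J × x i ≡ v)))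
  (a b : ℤ) (a≢b : a ≢ b) (a∈vs : a LM.∈ vs) (b∈vs : b LM.∈ vs) where

  open Transposition a b

  y : Fin (n ℕ.* n) → ℤ
  y = recolour τ J x

  x∈vs : ∀ {i} → i ∈ J → x i LM.∈ vs
  x∈vs i∈J = Equivalence.from (vs-values _) (_ , i∈J , refl)

  InRange : ℤ → Set
  InRange z = (+ 1 ℤ.≤ z) × (z ℤ.≤ + n)

  -- inside J the new values are values of x on J, hence in range
  y-range : ∀ i → InRange (y i)
  y-range i with i SP.∈? J
  ... | no _    = proj₁ x∈S i
  ... | yes i∈J with j , _ , xj≡τxi ← Equivalence.to (vs-values _) (τ-preserves a∈vs b∈vs (x∈vs i∈J)) =
    subst InRange xj≡τxi (proj₁ x∈S j)

  -- y satisfies the Sudoku condition for each permutation, by the exclusion property of J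
  y-rows : ∀ r → (Aπ n (perm D r) · y) <>0
  y-rows r = SudokuCondition.injectiveOn-cs⇒nonzero n (perm D r) y λ b →
    recolour-injectiveOn vs τ-injective (τ-preserves a∈vs b∈vs) x∈vs (x-injective b)
      (values-outside x x-injective vs length≤p x∈vs)
    where
    open Rectangle n (perm D r) J p q (proj₁ rectangle) (proj₁ (proj₂ rectangle r))
                   (proj₁ (proj₂ (proj₂ rectangle r))) (proj₂ (proj₂ (proj₂ rectangle r)))
    x-injective : ∀ b → InjectiveOn x (cs n (perm D r) b)
    x-injective = SudokuCondition.nonzero⇒injectiveOn-cs n (perm D r) x (proj₁ (proj₂ x∈S) r)

  -- the givens lie outside J, where y agrees with x
  y-givens : ∀ l → y (idx D l) ≡ g D l
  y-givens l = trans (recolour-outside (givens∉J l)) (proj₂ (proj₂ x∈S) l)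

  -- a cell of J where x takes the value a now carries b
  y-differs : ∃ λ i → y i ≢ x i
  y-differs with i , i∈J , xi≡a ← Equivalence.to (vs-values a) a∈vs = i , λ yi≡xi → a≢b (begin
    a        ≡⟨ sym xi≡a ⟩
    x i      ≡⟨ sym yi≡xi ⟩
    y i      ≡⟨ recolour-inside i∈J ⟩
    τ (x i)  ≡⟨ cong τ xi≡a ⟩
    τ a      ≡⟨ τ-a ⟩
    b        ∎)
    where open ≡-Reasoning

  second-solution : MoreThanOneSolution D
  second-solution = y , x , (y-range , y-rows , y-givens) , x∈S , y-differs

theorem6p1 : (n : ℕ) → 2 ≤ n → (D : SudokuData n)
    → (x : Fin (n Data.Nat.* n) → ℤ) → InS D x
    → (p q : ℕ) → 2 ≤ p → p ≤ n → 1 ≤ q → q ≤ n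
    → (J : Subset (n Data.Nat.* n)) → IsRectangle D p q J
    → (∀ l → idx D l ∉ J)
    → MinimalOn {n} x J p
    → MoreThanOneSolution D
theorem6p1 n _ D x x∈S p q 2≤p _ _ _ J rectangle givens∉J (vs , unique , length≡p , vs-values)
  with a , b , a≢b , a∈vs , b∈vs ← two-distinct-members vs unique (ℕP.≤-trans 2≤p (ℕP.≤-reflexive (sym length≡p)))
  = ExchangedSolution.second-solution D x x∈S p q J rectangle givens∉J
      vs (ℕP.≤-reflexive length≡p) vs-values a b a≢b a∈vs b∈vs
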